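{- If an axiom system $\mathcal{A}$ satisfies $\mathcal{A}\vdash\langle T\in D\rangle$ and $\mathcal{A}\vdash\sigma^{\mathcal{A}}$, then $\mathcal{A}$ is inconsistent.
   Context: Let $R=\{\mathrm{Mo},\mathrm{Tu},\mathrm{We},\mathrm{Th},\mathrm{Fr},\mathrm{none}\}$ be linearly ordered by $\mathrm{Mo}<\mathrm{Tu}<\mathrm{We}<\mathrm{Th}<\mathrm{Fr}<\mathrm{none}$, and $D=\{\mathrm{Mo},\dots,\mathrm{Fr}\}$. Propositional formulas are built from atoms $Y_r$ ($r\in R$) with $\bot,\to$ (usual derived connectives, $\top:=\neg\bot$). The axiom $(\mathrm{Ax}_{=1})$ is $\bigvee_{r\in R}Y_r\wedge\bigwedge_{r<s}(\neg Y_r\vee\neg Y_s)$; its models are identified with the elements of $R$ ($r$ makes exactly $Y_r$ true). An axiom system $\mathcal{A}$ is a set of formulas always containing $(\mathrm{Ax}_{=1})$; $\mathcal{A}\vdash\varphi$ is propositional provability; $\mathcal{A}$ is inconsistent if it proves every formula. For $B\subseteq R$: $\langle T\in B\rangle:=\bigvee_{r\in B}Y_r$. $K\subseteq R$ is an $\mathcal{A}$-p-knowledge set if $\mathcal{A}\vdash\langle T\in K\rangle$; $K_{\mathcal{A}}$ is the intersection of all of them. Iverson brackets: $[S]$ is $\top$ if the assertion $S$ is true, $\bot$ otherwise. $\sigma^{\mathcal{A}}:=\bigwedge_{K\subseteq R}\bigl([K_{\mathcal{A}}\subseteq K]\to\langle T\in K-\{\max K\}\rangle\bigr)$, with $\emptyset-\{\max\emptyset\}=\emptyset$.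 -}

module Defs where

open import Data.Nat using (ℕ; zero; suc)
open import Data.Fin using (Fin; zero; suc; _<_)
open import Data.Fin.Subset using (Subset; inside; outside; _∈_; _⊆_; _─_; ⁅_⁆)
import Data.Fin.Subset as S
open import Data.Bool using (Bool; true; false; if_then_else_)
open import Data.Maybe using (Maybe; just; nothing)
open import Data.List using (List; []; _∷_; _++_; map; foldr; concatMap; allFin)
open import Data.Vec using (Vec; []; _∷_; lookup)
open import Data.Product using (_×_; _,_)
open import Relation.Nullary using (¬_)
open import Relation.Binary.PropositionalEquality using (_≡_)

-- The set R of "days": Fin 6 with 0 = Mo, 1 = Tu, 2 = We, 3 = Th,
-- 4 = Fr, 5 = none; the linear order on R is the usual order on Fin 6.

R : Set
R = Fin 6

Mo Tu We Th Fr none : R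
Mo = zero
Tu = suc zero
We = suc (suc zero)
Th = suc (suc (suc zero))
Fr = suc (suc (suc (suc zero)))
none = suc (suc (suc (suc (suc zero))))

SubR : Set
SubR = Subset 6

D : SubR
D = inside ∷ inside ∷ inside ∷ inside ∷ inside ∷ outside ∷ []

infixr 5 _⇒_
data Formula : Set where
  Y   : R → Formula
  ⊥f  : Formula
  _⇒_ : Formula → Formula → Formula

¬f_ : Formula → Formula
¬f φ = φ ⇒ ⊥f

⊤f : Formula
⊤f = ¬f ⊥f

_∨f_ : Formula → Formula → Formula
φ ∨f ψ = (¬f φ) ⇒ ψ

_∧f_ : Formula → Formula → Formula
φ ∧f ψ = ¬f (φ ⇒ ¬f ψ)

⋁ : List Formula → Formula
⋁ = foldr _∨f_ ⊥f

⋀ : List Formula → Formula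
⋀ = foldr _∧f_ ⊤f

elems : ∀ {n} → Subset n → List (Fin n)
elems []            = []
elems (true  ∷ v)   = zero ∷ map suc (elems v)
elems (false ∷ v)   = map suc (elems v)

⟨T∈_⟩ : SubR → Formula
⟨T∈ B ⟩ = ⋁ (map Y (elems B))

pairsLt : List (R × R)
pairsLt = concatMap (λ r → concatMap (λ s → pick r s) (allFin 6)) (allFin 6)
  where
  pick : R → R → List (R × R)
  pick r s with Data.Fin._<?_ r s
  ... | Relation.Nullary.yes _ = (r , s) ∷ []
  ... | Relation.Nullary.no  _ = []

Ax₌₁ : Formula
Ax₌₁ = ⋁ (map Y (allFin 6))
   ∧f ⋀ (map (λ p → (¬f Y (Data.Product.proj₁ p)) ∨f (¬f Y (Data.Product.proj₂ p))) pairsLt)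

record AxiomSystem : Set₁ where
  field
    Ax      : Formula → Set
    hasAx₌₁ : Ax Ax₌₁
open AxiomSystem public

infix 3 _⊢_
data _⊢_ (𝒜 : AxiomSystem) : Formula → Set where
  hyp : ∀ {φ} → Ax 𝒜 φ → 𝒜 ⊢ φ
  A1  : ∀ {φ ψ} → 𝒜 ⊢ φ ⇒ (ψ ⇒ φ)
  A2  : ∀ {φ ψ χ} → 𝒜 ⊢ (φ ⇒ (ψ ⇒ χ)) ⇒ ((φ ⇒ ψ) ⇒ (φ ⇒ χ))
  A3  : ∀ {φ} → 𝒜 ⊢ (¬f (¬f φ)) ⇒ φ
  mp  : ∀ {φ ψ} → 𝒜 ⊢ φ ⇒ ψ → 𝒜 ⊢ φ → 𝒜 ⊢ ψ

Inconsistent : AxiomSystem → Set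
Inconsistent 𝒜 = ∀ φ → 𝒜 ⊢ φ

IsKnowledgeSet : AxiomSystem → SubR → Set
IsKnowledgeSet 𝒜 K = 𝒜 ⊢ ⟨T∈ K ⟩

-- membership in K_𝒜 = ⋂ { K | K is an 𝒜-p-knowledge set }
_∈K[_] : R → AxiomSystem → Set
r ∈K[ 𝒜 ] = ∀ K → IsKnowledgeSet 𝒜 K → r ∈ K

K[_]⊆_ : AxiomSystem → SubR → Set
K[ 𝒜 ]⊆ K = ∀ {r} → r ∈K[ 𝒜 ] → r ∈ K

maxOf : ∀ {n} → Subset n → Maybe (Fin n)
maxOf []      = nothing
maxOf (b ∷ v) with maxOf v
... | just i  = just (suc i)
... | nothing = if b then just zero else nothing

-- K - {max K}, with ∅ - {max ∅} = ∅
removeMax : SubR → SubR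
removeMax K with maxOf K
... | just m  = K ─ ⁅ m ⁆
... | nothing = S.⊥

IsIverson : Set → Formula → Set
IsIverson P φ = (P → φ ≡ ⊤f) × (¬ P → φ ≡ ⊥f)

allSubsets : ∀ n → List (Subset n)
allSubsets zero    = [] ∷ []
allSubsets (suc n) = map (inside ∷_) (allSubsets n) ++ map (outside ∷_) (allSubsets n)

-- σ^𝒜, given the family of brackets br K = [K_𝒜 ⊆ K]
σ : (SubR → Formula) → Formula
σ br = ⋀ (map (λ K → br K ⇒ ⟨T∈ removeMax K ⟩) (allSubsets 6))

IsBracketFamily : AxiomSystem → (SubR → Formula) → Set
IsBracketFamily 𝒜 br = ∀ K → IsIverson (K[ 𝒜 ]⊆ K) (br K)

{-# OPTIONS --safe #-}
module Submission where

open import Defs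
open import Data.Bool using (true; false)
import Data.Fin.Subset as Subset
open import Data.List using (List; []; _∷_; map)
open import Data.List.Membership.Propositional using (_∈_)
open import Data.List.Membership.Propositional.Properties using (∈-map⁺; ∈-++⁺ˡ; ∈-++⁺ʳ)
open import Data.List.Relation.Unary.Any using (here; there)
open import Data.Nat using (zero; suc)
open import Data.Nat.GeneralisedArithmetic using (iterate)
open import Data.Product using (proj₁)
open import Data.Vec using ([]; _∷_)
open import Relation.Binary.PropositionalEquality using (_≡_; refl; sym; subst)

-- If ⟨T ∈ K⟩ is provable then K_𝒜 ⊆ K, so the bracket [K_𝒜 ⊆ K]
-- is ⊤ and the K-conjunct of σ^𝒜 yields ⟨T ∈ K - {max K}⟩. Starting from D and
-- removing the maximum five times reaches ⟨T ∈ ∅⟩ = ⊥.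

module _ {𝒜 : AxiomSystem} where

  ⇒-refl : ∀ {φ} → 𝒜 ⊢ φ ⇒ φ
  ⇒-refl {φ} = mp (mp (A2 {ψ = φ ⇒ φ}) A1) (A1 {ψ = φ})

  ⊤-intro : 𝒜 ⊢ ⊤f
  ⊤-intro = ⇒-refl

  infix 3 _⊩_
  data _⊩_ (Γ : List Formula) : Formula → Set where
    theorem : ∀ {φ} → 𝒜 ⊢ φ → Γ ⊩ φ
    assume  : ∀ {φ} → φ ∈ Γ → Γ ⊩ φ
    ⇒-elim  : ∀ {φ ψ} → Γ ⊩ φ ⇒ ψ → Γ ⊩ φ → Γ ⊩ ψ

  ⇒-intro : ∀ {Γ φ ψ} → φ ∷ Γ ⊩ ψ → Γ ⊩ φ ⇒ ψ
  ⇒-intro (theorem p)          = theorem (mp A1 p)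
  ⇒-intro (assume (here refl)) = theorem ⇒-refl
  ⇒-intro (assume (there φ∈Γ)) = ⇒-elim (theorem A1) (assume φ∈Γ)
  ⇒-intro (⇒-elim p q)         = ⇒-elim (⇒-elim (theorem A2) (⇒-intro p)) (⇒-intro q)

  weaken : ∀ {Γ φ ψ} → Γ ⊩ ψ → φ ∷ Γ ⊩ ψ
  weaken (theorem p)  = theorem p
  weaken (assume ψ∈Γ) = assume (there ψ∈Γ)
  weaken (⇒-elim p q) = ⇒-elim (weaken p) (weaken q)

  closed : ∀ {φ} → [] ⊩ φ → 𝒜 ⊢ φ
  closed (theorem p)  = p
  closed (assume ())
  closed (⇒-elim p q) = mp (closed p) (closed q)

  by-contradiction : ∀ {Γ φ} → ¬f φ ∷ Γ ⊩ ⊥f → Γ ⊩ φ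
  by-contradiction p = ⇒-elim (theorem A3) (⇒-intro p)

  ⊥-elim : ∀ {Γ φ} → Γ ⊩ ⊥f → Γ ⊩ φ
  ⊥-elim p = by-contradiction (weaken p)

  ⊢⊥⇒inconsistent : 𝒜 ⊢ ⊥f → Inconsistent 𝒜
  ⊢⊥⇒inconsistent p _ = closed (⊥-elim (theorem p))

  ∧-elimˡ : ∀ {φ ψ} → 𝒜 ⊢ φ ∧f ψ → 𝒜 ⊢ φ
  ∧-elimˡ p = closed (by-contradiction (⇒-elim (theorem p) (⇒-intro
    (⊥-elim (⇒-elim (assume (there (here refl))) (assume (here refl)))))))

  ∧-elimʳ : ∀ {φ ψ} → 𝒜 ⊢ φ ∧f ψ → 𝒜 ⊢ ψ
  ∧-elimʳ p = closed (by-contradiction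
    (⇒-elim (theorem p) (⇒-elim (theorem A1) (assume (here refl)))))

  ⋀-elim : ∀ {B : Set} (f : B → Formula) {xs x} →
           𝒜 ⊢ ⋀ (map f xs) → x ∈ xs → 𝒜 ⊢ f x
  ⋀-elim f p (here refl)  = ∧-elimˡ p
  ⋀-elim f p (there x∈xs) = ⋀-elim f (∧-elimʳ p) x∈xs

∈-allSubsets : ∀ {n} (K : Subset.Subset n) → K ∈ allSubsets n
∈-allSubsets []                 = here refl
∈-allSubsets {suc n} (true ∷ K)  = ∈-++⁺ˡ (∈-map⁺ (true ∷_) (∈-allSubsets K))
∈-allSubsets {suc n} (false ∷ K) =
  ∈-++⁺ʳ (map (true ∷_) (allSubsets n)) (∈-map⁺ (false ∷_) (∈-allSubsets K))

knowledgeSet⇒K⊆ : ∀ {𝒜} K → IsKnowledgeSet 𝒜 K → K[ 𝒜 ]⊆ K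
knowledgeSet⇒K⊆ K ⊢K r∈K𝒜 = r∈K𝒜 K ⊢K

module _ {𝒜 : AxiomSystem} {br : SubR → Formula}
         (isBracket : IsBracketFamily 𝒜 br) (⊢σ : 𝒜 ⊢ σ br) where

  σ-removeMax : ∀ K → IsKnowledgeSet 𝒜 K → IsKnowledgeSet 𝒜 (removeMax K)
  σ-removeMax K ⊢K = mp (⋀-elim (λ K → br K ⇒ ⟨T∈ removeMax K ⟩) ⊢σ (∈-allSubsets K))
                        ⊢bracket
    where
    ⊢bracket : 𝒜 ⊢ br K
    ⊢bracket = subst (𝒜 ⊢_) (sym (proj₁ (isBracket K) (knowledgeSet⇒K⊆ K ⊢K))) ⊤-intro

  σ-iterate-removeMax : ∀ K → IsKnowledgeSet 𝒜 K →
                        ∀ n → IsKnowledgeSet 𝒜 (iterate removeMax K n)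
  σ-iterate-removeMax K ⊢K zero    = ⊢K
  σ-iterate-removeMax K ⊢K (suc n) =
    σ-iterate-removeMax (removeMax K) (σ-removeMax K ⊢K) n

removeMax⁵-D : iterate removeMax D 5 ≡ Subset.⊥
removeMax⁵-D = refl

corollary4p2 : (𝒜 : AxiomSystem) → 𝒜 ⊢ ⟨T∈ D ⟩ →
    (br : SubR → Formula) → IsBracketFamily 𝒜 br → 𝒜 ⊢ σ br →
    Inconsistent 𝒜
corollary4p2 𝒜 ⊢D br isBracket ⊢σ =
  ⊢⊥⇒inconsistent (subst (λ K → 𝒜 ⊢ ⟨T∈ K ⟩) removeMax⁵-D
    (σ-iterate-removeMax isBracket ⊢σ D ⊢D 5))
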